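{- Let $G$ be a finite fully regular graph with parameters $a_0,a_1,\dots,a_\alpha$, where $\alpha=\alpha(G)$ is the size of a largest independent set of $G$. Then $$\sigma'(G)=\sum_{i=0}^{\alpha}\prod_{j=1}^i\frac{ -a_j}{a_0-a_j},\qquad \sigma(G)=a_0!\sum_{i=0}^{\alpha}\prod_{j=1}^i\frac{ -a_j}{a_0-a_j}.$$
   Context: A linear ordering $\pi:V(G)\to\{1,\dots,|V(G)|\}$ of the vertices of a graph $G$ is called successive if for every $i\ge 1$ the subgraph of $G$ induced by $\{v:\pi(v)\le i\}$ is connected. $\sigma(G)$ denotes the number of successive orderings of $V(G)$ and $\sigma'(G)=\sigma(G)/|V(G)|!$ is the probability that a uniformly random linear ordering is successive. A graph $G$ is fully regular if there are numbers $a_0,a_1,\dots,a_{\alpha(G)}$ (its parameters) such that for every independent set $I\subseteq V(G)$, the number of vertices in $V(G)\setminus I$ not adjacent to any element of $I$ equals $a_{|I|}$; thus $a_0=|V(G)|$ and $a_{\alpha(G)}=0$. Empty products are equal to $1$. -}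

module Defs where

open import Data.Nat using (ℕ; zero; suc; _<_; _≤_)
open import Data.Nat using (_!)
open import Data.Bool using (Bool; true; false; not; _∧_; T)
open import Data.Fin using (Fin; toℕ)
import Data.Fin as Fin
open import Data.List using (List; []; _∷_; length; filter; take; allFin)
open import Data.Bool.ListAction using (all; any)
import Data.Integer as ℤ
open import Data.List.Membership.Propositional using (_∈_)
open import Data.List.Relation.Unary.Unique.Propositional using (Unique)
open import Data.List.Relation.Unary.AllPairs using (AllPairs)
open import Data.Product using (Σ; _×_; _,_)
open import Function.Bundles using (_⇔_)
open import Relation.Binary.PropositionalEquality using (_≡_)
open import Relation.Nullary.Decidable using (⌊_⌋)
open import Data.Rational using (ℚ; _+_; _*_; _-_; -_; _÷_; 0ℚ; 1ℚ)
import Data.Rational as ℚ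
open import Data.Rational.Properties using ()
open import Relation.Nullary using (yes; no)
open import Data.Rational.Base using (NonZero)

record Graph (n : ℕ) : Set where
  field
    adj    : Fin n → Fin n → Bool
    sym    : ∀ u v → adj u v ≡ adj v u
    irrefl : ∀ v → adj v v ≡ false
open Graph public

module _ {n : ℕ} (G : Graph n) where

  data Reach (S : Fin n → Set) (u : Fin n) : Fin n → Set where
    here : S u → Reach S u u
    step : ∀ {w v} → Reach S u w → T (adj G w v) → S v → Reach S u v

  -- the subgraph induced by S is connected
  -- (the empty vertex set counts as connected, vacuously)
  InducedConnected : (Fin n → Set) → Set
  InducedConnected S = ∀ u v → S u → S v → Reach S u v

  -- A linear ordering π : V → {1..n} is encoded as the list of vertices
  -- in increasing order of π (the i-th entry, 1-based, is π⁻¹(i)).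
  IsOrdering : List (Fin n) → Set
  IsOrdering l = length l ≡ n × Unique l × (∀ v → v ∈ l)

  -- successive: for every i ≥ 1, the set {v : π(v) ≤ i} (= the first i
  -- entries of the list) induces a connected subgraph
  Successive : List (Fin n) → Set
  Successive l = ∀ i → 1 ≤ i → InducedConnected (λ v → v ∈ take i l)

  SuccessiveOrdering : List (Fin n) → Set
  SuccessiveOrdering l = IsOrdering l × Successive l

  Independent : List (Fin n) → Set
  Independent I = Unique I × AllPairs (λ u v → adj G u v ≡ false) I

  nonNeighbours : List (Fin n) → ℕ
  nonNeighbours I =
    length (filter (λ v → T? (not (any (λ u → ⌊ u Fin.≟ v ⌋) I)
                              ∧ all (λ u → not (adj G u v)) I))
                   (allFin n))
    where
      open import Data.Bool.Properties using () renaming (T? to T?)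

  IsIndependenceNumber : ℕ → Set
  IsIndependenceNumber α =
    Σ (List (Fin n)) (λ I → Independent I × length I ≡ α)
    × (∀ I → Independent I → length I ≤ α)

  -- G is fully regular with parameters a₀,…,a_α (a given as ℕ → ℕ;
  -- only the values a 0 … a α matter)
  FullyRegular : (α : ℕ) → (ℕ → ℕ) → Set
  FullyRegular α a = IsIndependenceNumber α
    × (∀ I → Independent I → nonNeighbours I ≡ a (length I))

HasCount : {A : Set} → (A → Set) → ℕ → Set
HasCount {A} P k =
  Σ (List A) (λ L → Unique L × length L ≡ k × (∀ x → (x ∈ L ⇔ P x)))

-- total division on ℚ; only ever used with nonzero denominator here
-- (a₀ - a_j > 0 for 1 ≤ j ≤ α), the value at q = 0 is irrelevant
_÷'_ : ℚ → ℚ → ℚ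
p ÷' q with q ℚ.≟ 0ℚ
... | yes _ = 0ℚ
... | no q≢0 = p ÷ q
  where instance _ = ℚ.≢-nonZero q≢0

ℕtoℚ : ℕ → ℚ
ℕtoℚ m = (ℤ.+ m) ℚ./ 1

prodTerm : (ℕ → ℕ) → ℕ → ℚ
prodTerm a zero    = 1ℚ
prodTerm a (suc i) = prodTerm a i *
  ((- ℕtoℚ (a (suc i))) ÷' (ℕtoℚ (a 0) - ℕtoℚ (a (suc i))))

sumTerm : (ℕ → ℕ) → ℕ → ℚ
sumTerm a zero    = prodTerm a zero
sumTerm a (suc α) = sumTerm a α + prodTerm a (suc α)

-- An ordering π is successive exactly when its first vertex f is the only vertex that is locally
-- first, i.e. precedes all of its neighbours in π.  Call a stable chain x_i ∷ … ∷ x₁ led by π when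
-- every x_j comes first in π among the closed neighbourhood of x_j ∷ … ∷ x₁; the led chains are
-- exactly the sets of locally first vertices, each listed from its latest to its earliest element.
-- So the sum of (−1)^i over the led chains whose neighbourhood misses f is 1 if π is successive
-- and 0 otherwise: adding or removing the earliest locally first vertex b ≠ f cancels the terms in
-- pairs.  Summed over all n! orderings instead, a stable chain of length i is led, with f outside
-- its neighbourhood, by a_i (n−1)! / ∏_{j≤i} (n − a_j) orderings, and by full regularity it has
-- a_i one-vertex extensions.  The resulting Horner-type recursion in i expands to
-- n! ∑_i ∏_{j≤i} −a_j / (a₀ − a_j).

module Submission where

open import Defs hiding (sym)

open import Algebra.Bundles using (CommutativeMonoid)
open import Algebra.Structures using (IsCommutativeMonoid)
import Algebra.Properties.CommutativeSemigroup as CommutativeSemigroupProperties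
open import Data.Bool using (Bool; true; false; not; _∧_; _∨_; T; if_then_else_)
open import Data.Bool.ListAction using (any; all)
open import Data.Bool.Properties
  using (T?; T-≡; not-¬; ∧-conicalˡ; ∧-conicalʳ; ∧-zeroʳ; ∧-identityʳ; ∨-conicalʳ; ∨-zeroʳ)
open import Data.Empty using (⊥; ⊥-elim)
open import Data.Fin as Fin using (Fin)
open import Data.Integer as ℤ using (+_)
import Data.Integer.Properties as ℤ
open import Data.Integer.Tactic.RingSolver using (solve-∀)
open import Data.List using (List; []; _∷_; length; filter; map; concatMap; _++_; take; allFin)
open import Data.List.Membership.Propositional using (_∈_; find; lose)
import Data.List.Membership.Propositional.Properties as ∈
open import Data.List.Membership.Propositional.Properties.WithK using (unique∧set⇒bag)
import Data.List.Properties as List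
open import Data.List.Relation.Binary.BagAndSetEquality using (∼bag⇒↭)
open import Data.List.Relation.Binary.Permutation.Propositional.Properties using (↭-length)
open import Data.List.Relation.Unary.All as All using (All; []; _∷_)
open import Data.List.Relation.Unary.AllPairs using ([]; _∷_)
open import Data.List.Relation.Unary.Any using (here; there)
open import Data.List.Relation.Unary.Unique.Propositional using (Unique)
import Data.List.Relation.Unary.Unique.Propositional.Properties as Unique
open import Data.Maybe using (Maybe; just; nothing; is-nothing; maybe)
open import Data.Nat as ℕ using (ℕ; zero; suc; _!; _≤_; _<_; z≤n; s≤s)
import Data.Nat.Properties as ℕ
open import Data.Nat.Properties using (_!≢0)
open import Data.Product using (∃-syntax; _×_; _,_; proj₁; proj₂)
open import Data.Rational as ℚ using (ℚ; 0ℚ; 1ℚ; _*_)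
open import Data.Rational.Literals using (fromℤ)
import Data.Rational.Properties as ℚ
open import Data.Rational.Solver using () renaming (module +-*-Solver to ℚSolver)
import Data.Rational.Unnormalised as ℚᵘ
import Data.Rational.Unnormalised.Properties as ℚᵘ
open import Data.Sum using (_⊎_; inj₁; inj₂)
open import Data.Unit using (⊤; tt)
open import Function.Base using (_∘_; case_of_)
open import Function.Bundles using (_⇔_; mk⇔; Equivalence)
open import Relation.Binary.Definitions using (DecidableEquality)
open import Relation.Binary.PropositionalEquality
open import Relation.Nullary using (¬_; yes; no; does; contradiction)
import Relation.Nullary.Decidable as Dec
open import Relation.Nullary.Decidable using (¬?; ⌊_⌋)

private variable A B : Set

unique-length : ∀ {xs ys : List A} → Unique xs → Unique ys → (∀ {x} → x ∈ xs ⇔ x ∈ ys) → length xs ≡ length ys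
unique-length xs-unique ys-unique xs≈ys = ↭-length (∼bag⇒↭ (unique∧set⇒bag xs-unique ys-unique xs≈ys))

count : (A → Bool) → List A → ℕ
count p []       = 0
count p (x ∷ xs) = if p x then suc (count p xs) else count p xs

count-cong : ∀ {p q : A → Bool} xs → (∀ x → x ∈ xs → p x ≡ q x) → count p xs ≡ count q xs
count-cong           []       _  = refl
count-cong {q = q} (x ∷ xs) eq rewrite eq x (here refl) with q x
... | true  = cong suc (count-cong xs (λ y y∈ → eq y (there y∈)))
... | false = count-cong xs (λ y y∈ → eq y (there y∈))

module _ (p : A → Bool) where

  length-filter-T? : ∀ xs → length (filter (λ x → T? (p x)) xs) ≡ count p xs
  length-filter-T? []       = refl
  length-filter-T? (x ∷ xs) with p x
  ... | true  = cong suc (length-filter-T? xs)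
  ... | false = length-filter-T? xs

  count-none : ∀ xs → (∀ x → x ∈ xs → p x ≡ false) → count p xs ≡ 0
  count-none []       _    = refl
  count-none (x ∷ xs) none rewrite none x (here refl) = count-none xs (λ y y∈ → none y (there y∈))

  count-≢0 : ∀ {xs x} → x ∈ xs → p x ≡ true → count p xs ≢ 0
  count-≢0 {y ∷ xs} (here refl) px rewrite px = λ ()
  count-≢0 {y ∷ xs} (there x∈) px with p y
  ... | true  = λ ()
  ... | false = count-≢0 x∈ px

  count-not+count : ∀ xs → count (λ x → not (p x)) xs ℕ.+ count p xs ≡ length xs
  count-not+count []       = refl
  count-not+count (x ∷ xs) with p x
  ... | true  = trans (ℕ.+-suc _ _) (cong suc (count-not+count xs))
  ... | false = cong suc (count-not+count xs)

  count-++ : ∀ xs ys → count p (xs ++ ys) ≡ count p xs ℕ.+ count p ys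
  count-++ []       ys = refl
  count-++ (x ∷ xs) ys with p x
  ... | true  = cong suc (count-++ xs ys)
  ... | false = count-++ xs ys

count-true : (xs : List A) → count (λ _ → true) xs ≡ length xs
count-true []       = refl
count-true (_ ∷ xs) = cong suc (count-true xs)

count-map : (p : B → Bool) (f : A → B) (xs : List A) → count p (map f xs) ≡ count (λ x → p (f x)) xs
count-map p f []       = refl
count-map p f (x ∷ xs) with p (f x)
... | true  = cong suc (count-map p f xs)
... | false = count-map p f xs

module ListSum {M : Set} {_∙_ : M → M → M} {ε : M} (isCM : IsCommutativeMonoid _≡_ _∙_ ε) where

  open IsCommutativeMonoid isCM using (assoc; comm; identityˡ; identityʳ)

  interchange : ∀ a b c d → (a ∙ b) ∙ (c ∙ d) ≡ (a ∙ c) ∙ (b ∙ d)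
  interchange a b c d = begin
    (a ∙ b) ∙ (c ∙ d)  ≡⟨ assoc a b (c ∙ d) ⟩
    a ∙ (b ∙ (c ∙ d))  ≡⟨ cong (a ∙_) (sym (assoc b c d)) ⟩
    a ∙ ((b ∙ c) ∙ d)  ≡⟨ cong (λ x → a ∙ (x ∙ d)) (comm b c) ⟩
    a ∙ ((c ∙ b) ∙ d)  ≡⟨ cong (a ∙_) (assoc c b d) ⟩
    a ∙ (c ∙ (b ∙ d))  ≡⟨ sym (assoc a c (b ∙ d)) ⟩
    (a ∙ c) ∙ (b ∙ d)  ∎
    where open ≡-Reasoning

  sum : List A → (A → M) → M
  sum []       f = ε
  sum (x ∷ xs) f = f x ∙ sum xs f

  module _ {f g : A → M} where

    sum-cong : ∀ xs → (∀ x → x ∈ xs → f x ≡ g x) → sum xs f ≡ sum xs g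
    sum-cong []       _  = refl
    sum-cong (x ∷ xs) eq = cong₂ _∙_ (eq x (here refl)) (sum-cong xs (λ y y∈ → eq y (there y∈)))

    sum-∙ : ∀ xs → sum xs (λ x → f x ∙ g x) ≡ sum xs f ∙ sum xs g
    sum-∙ []       = sym (identityˡ ε)
    sum-∙ (x ∷ xs) = trans (cong ((f x ∙ g x) ∙_) (sum-∙ xs)) (interchange (f x) (g x) (sum xs f) (sum xs g))

  sum-ε : ∀ (xs : List A) {f} → (∀ x → x ∈ xs → f x ≡ ε) → sum xs f ≡ ε
  sum-ε []       _    = refl
  sum-ε (x ∷ xs) f≡ε =
    trans (cong₂ _∙_ (f≡ε x (here refl)) (sum-ε xs (λ y y∈ → f≡ε y (there y∈)))) (identityˡ ε)

  sum-single : ∀ {xs : List A} {f b} → Unique xs → b ∈ xs → (∀ x → x ≢ b → f x ≡ ε) → sum xs f ≡ f b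
  sum-single {xs = x ∷ xs} {f = f} (x∉ ∷ _)  (here refl) f≡ε =
    trans (cong (f x ∙_) (sum-ε xs (λ y y∈ → f≡ε y (λ { refl → All.lookup x∉ y∈ refl })))) (identityʳ _)
  sum-single {xs = x ∷ xs} {f = f} (x∉ ∷ u) (there b∈)  f≡ε =
    trans (cong₂ _∙_ (f≡ε x (λ { refl → All.lookup x∉ b∈ refl })) (sum-single u b∈ f≡ε)) (identityˡ _)

  sum-swap : ∀ (xs : List A) (ys : List B) (h : A → B → M) →
             sum xs (λ x → sum ys (h x)) ≡ sum ys (λ y → sum xs (λ x → h x y))
  sum-swap []       ys h = sym (sum-ε ys (λ _ _ → refl))
  sum-swap (x ∷ xs) ys h = trans (cong (sum ys (h x) ∙_) (sum-swap xs ys h)) (sym (sum-∙ ys))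

open ListSum ℕ.+-0-isCommutativeMonoid using ()
  renaming (sum to sumℕ; sum-cong to sumℕ-cong; sum-∙ to sumℕ-+; sum-ε to sumℕ-0; sum-single to sumℕ-single)

module ℕ-* = CommutativeSemigroupProperties (CommutativeMonoid.commutativeSemigroup ℕ.*-1-commutativeMonoid)

sumℕ-*ʳ : ∀ (xs : List A) f c → sumℕ xs f ℕ.* c ≡ sumℕ xs (λ x → f x ℕ.* c)
sumℕ-*ʳ []       f c = refl
sumℕ-*ʳ (x ∷ xs) f c = trans (ℕ.*-distribʳ-+ c (f x) (sumℕ xs f)) (cong (f x ℕ.* c ℕ.+_) (sumℕ-*ʳ xs f c))

sumℕ-if : ∀ (p : A → Bool) c xs → sumℕ xs (λ x → if p x then c else 0) ≡ count p xs ℕ.* c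
sumℕ-if p c []       = refl
sumℕ-if p c (x ∷ xs) with p x
... | true  = cong (c ℕ.+_) (sumℕ-if p c xs)
... | false = sumℕ-if p c xs

sumℕ-split : ∀ (p : A → Bool) xs f →
  sumℕ xs f ≡ sumℕ xs (λ x → if p x then 0 else f x) ℕ.+ sumℕ xs (λ x → if p x then f x else 0)
sumℕ-split p xs f = trans (sumℕ-cong xs (λ x _ → split x (p x))) (sumℕ-+ xs)
  where
  split : ∀ x b → f x ≡ (if b then 0 else f x) ℕ.+ (if b then f x else 0)
  split x true  = refl
  split x false = sym (ℕ.+-identityʳ (f x))

module Orderings {A : Set} (_≟_ : DecidableEquality A) where

  _∖_ : List A → A → List A
  U ∖ x = filter (λ y → ¬? (x ≟ y)) U

  ∖-unique : ∀ {U} x → Unique U → Unique (U ∖ x)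
  ∖-unique x = Unique.filter⁺ (λ y → ¬? (x ≟ y))

  ∈-∖⁺ : ∀ {U x y} → y ∈ U → x ≢ y → y ∈ U ∖ x
  ∈-∖⁺ = ∈.∈-filter⁺ (λ y → ¬? (_ ≟ y))

  ∈-∖⁻ : ∀ U {x y} → y ∈ U ∖ x → y ∈ U × x ≢ y
  ∈-∖⁻ U = ∈.∈-filter⁻ (λ y → ¬? (_ ≟ y)) {xs = U}

  length-∖ : ∀ {U x} → Unique U → x ∈ U → suc (length (U ∖ x)) ≡ length U
  length-∖ {y ∷ U} {x} (y∉ ∷ _) (here refl)
    rewrite List.filter-reject (λ z → ¬? (x ≟ z)) {x} {U} (λ x≢x → x≢x refl) =
      cong (suc ∘ length) (List.filter-all (λ z → ¬? (x ≟ z)) y∉)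
  length-∖ {y ∷ U} {x} (y∉ ∷ u) (there x∈) with x ≟ y
  ... | yes refl = ⊥-elim (All.lookup y∉ x∈ refl)
  ... | no _     = cong suc (length-∖ u x∈)

  count-∖ : ∀ (p : A → Bool) {x} U → p x ≡ false → count p (U ∖ x) ≡ count p U
  count-∖ p {x} []      _  = refl
  count-∖ p {x} (y ∷ U) px with x ≟ y
  ... | yes refl rewrite px = count-∖ p U px
  ... | no _ with p y
  ...   | true  = cong suc (count-∖ p U px)
  ...   | false = count-∖ p U px

  orderings : ℕ → List A → List (List A)
  orderings zero    U = [] ∷ []
  orderings (suc k) U = concatMap (λ x → map (x ∷_) (orderings k (U ∖ x))) U

  count-orderings : ∀ (p : List A → Bool) k U →
    count p (orderings (suc k) U) ≡ sumℕ U (λ x → count (λ π → p (x ∷ π)) (orderings k (U ∖ x)))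
  count-orderings p k U = count-blocks U
    where
    count-blocks : ∀ W → count p (concatMap (λ x → map (x ∷_) (orderings k (U ∖ x))) W)
                         ≡ sumℕ W (λ x → count (λ π → p (x ∷ π)) (orderings k (U ∖ x)))
    count-blocks []      = refl
    count-blocks (x ∷ W) = trans (count-++ p (map (x ∷_) (orderings k (U ∖ x))) _)
      (cong₂ ℕ._+_ (count-map p (x ∷_) (orderings k (U ∖ x))) (count-blocks W))

  private
    blocks : ℕ → List A → List A → List (List A)
    blocks k U = concatMap (λ x → map (x ∷_) (orderings k (U ∖ x)))

    ∈-blocks⁻ : ∀ k U W {π} → π ∈ blocks k U W →
                ∃[ x ] ∃[ π′ ] x ∈ W × π′ ∈ orderings k (U ∖ x) × π ≡ x ∷ π′
    ∈-blocks⁻ k U W π∈ with find (∈.∈-concatMap⁻ _ {xs = W} π∈)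
    ... | x , x∈ , π∈x with ∈.∈-map⁻ (x ∷_) π∈x
    ...   | π′ , π′∈ , refl = x , π′ , x∈ , π′∈ , refl

    ∈-blocks⁺ : ∀ k U W {x π′} → x ∈ W → π′ ∈ orderings k (U ∖ x) → x ∷ π′ ∈ blocks k U W
    ∈-blocks⁺ k U W x∈ π′∈ = ∈.∈-concatMap⁺ _ {xs = W} (lose x∈ (∈.∈-map⁺ (_ ∷_) π′∈))

  orderings-unique : ∀ k {U} → Unique U → Unique (orderings k U)
  orderings-unique zero    _ = [] ∷ []
  orderings-unique (suc k) {U} u = blocks-unique u
    where
    blocks-unique : ∀ {W} → Unique W → Unique (blocks k U W)
    blocks-unique []              = []
    blocks-unique {x ∷ W} (x∉ ∷ w) =
      Unique.++⁺ (Unique.map⁺ List.∷-injectiveʳ (orderings-unique k (∖-unique x u))) (blocks-unique w) disjoint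
      where
      disjoint : ∀ {π} → ¬ (π ∈ map (x ∷_) (orderings k (U ∖ x)) × π ∈ blocks k U W)
      disjoint (π∈ , π∈W) with ∈.∈-map⁻ (x ∷_) π∈ | ∈-blocks⁻ k U W π∈W
      ... | _ , _ , refl | y , _ , y∈ , _ , eq = All.lookup x∉ y∈ (List.∷-injectiveˡ eq)

  ∈-orderings⁻ : ∀ k {U π} → Unique U → length U ≡ k → π ∈ orderings k U →
                 Unique π × (∀ {v} → v ∈ π ⇔ v ∈ U)
  ∈-orderings⁻ zero    {[]} _ _ (here refl) = [] , mk⇔ (λ ()) (λ ())
  ∈-orderings⁻ (suc k) {U}  u l π∈ with ∈-blocks⁻ k U U π∈
  ... | x , π′ , x∈ , π′∈ , refl
    with ∈-orderings⁻ k (∖-unique x u) (ℕ.suc-injective (trans (length-∖ u x∈) l)) π′∈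
  ...   | π′-unique , π′≈ =
    All.tabulate (λ y∈ x≡y → proj₂ (∈-∖⁻ U (Equivalence.to π′≈ y∈)) x≡y) ∷ π′-unique , mk⇔ to from
    where
    to : ∀ {v} → v ∈ x ∷ π′ → v ∈ U
    to (here refl) = x∈
    to (there v∈)  = proj₁ (∈-∖⁻ U (Equivalence.to π′≈ v∈))
    from : ∀ {v} → v ∈ U → v ∈ x ∷ π′
    from {v} v∈ with x ≟ v
    ... | yes refl = here refl
    ... | no x≢v   = there (Equivalence.from π′≈ (∈-∖⁺ v∈ x≢v))

  ∈-orderings⁺ : ∀ k {U π} → Unique U → length U ≡ k → Unique π → (∀ {v} → v ∈ π ⇔ v ∈ U) →
                 π ∈ orderings k U
  ∈-orderings⁺ zero    {[]}    {[]}    _ _ _ _  = here refl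
  ∈-orderings⁺ zero    {[]}    {x ∷ π} _ _ _ π≈ with Equivalence.to π≈ (here refl)
  ... | ()
  ∈-orderings⁺ (suc k) {y ∷ U} {[]}    _ _ _ π≈ with Equivalence.from π≈ (here refl)
  ... | ()
  ∈-orderings⁺ (suc k) {U}     {x ∷ π} u l (x∉ ∷ π-unique) π≈ =
    ∈-blocks⁺ k U U x∈ (∈-orderings⁺ k (∖-unique x u) (ℕ.suc-injective (trans (length-∖ u x∈) l)) π-unique
      (mk⇔ (λ v∈ → ∈-∖⁺ (Equivalence.to π≈ (there v∈)) (λ { refl → All.lookup x∉ v∈ refl })) from))
    where
    x∈ = Equivalence.to π≈ (here refl)
    from : ∀ {v} → v ∈ U ∖ x → v ∈ π
    from v∈ with ∈-∖⁻ U v∈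
    ... | v∈U , x≢v with Equivalence.from π≈ v∈U
    ...   | here refl = ⊥-elim (x≢v refl)
    ...   | there v∈π = v∈π

ℕtoℚ≡fromℤ : ∀ m → ℕtoℚ m ≡ fromℤ (+ m)
ℕtoℚ≡fromℤ m = ℚ.normalize-coprime {m} {0} _

private
  toℚᵘ-ℕtoℚ : ∀ m → ℚ.toℚᵘ (ℕtoℚ m) ℚᵘ.≃ ℚ.toℚᵘ (fromℤ (+ m))
  toℚᵘ-ℕtoℚ m = ℚ.toℚᵘ-cong (ℕtoℚ≡fromℤ m)

ℕtoℚ-+ : ∀ m n → ℕtoℚ (m ℕ.+ n) ≡ ℕtoℚ m ℚ.+ ℕtoℚ n
ℕtoℚ-+ m n = ℚ.toℚᵘ-injective (ℚᵘ.≃-trans (toℚᵘ-ℕtoℚ (m ℕ.+ n)) (ℚᵘ.≃-trans (ℚᵘ.*≡* (lemma (+ m) (+ n)))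
  (ℚᵘ.≃-sym (ℚᵘ.≃-trans (ℚ.toℚᵘ-homo-+ (ℕtoℚ m) (ℕtoℚ n))
    (ℚᵘ.+-cong (toℚᵘ-ℕtoℚ m) (toℚᵘ-ℕtoℚ n))))))
  where
  lemma : ∀ x y → (x ℤ.+ y) ℤ.* + 1 ≡ (x ℤ.* + 1 ℤ.+ y ℤ.* + 1) ℤ.* + 1
  lemma = solve-∀

ℕtoℚ-* : ∀ m n → ℕtoℚ (m ℕ.* n) ≡ ℕtoℚ m ℚ.* ℕtoℚ n
ℕtoℚ-* m n = ℚ.toℚᵘ-injective (ℚᵘ.≃-trans (toℚᵘ-ℕtoℚ (m ℕ.* n))
  (ℚᵘ.≃-trans (ℚᵘ.*≡* (cong (ℤ._* + 1) (ℤ.pos-* m n)))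
  (ℚᵘ.≃-sym (ℚᵘ.≃-trans (ℚ.toℚᵘ-homo-* (ℕtoℚ m) (ℕtoℚ n))
    (ℚᵘ.*-cong (toℚᵘ-ℕtoℚ m) (toℚᵘ-ℕtoℚ n))))))

ℕtoℚ-≢0 : ∀ {m} → m ≢ 0 → ℕtoℚ m ≢ 0ℚ
ℕtoℚ-≢0 {zero}  m≢0 _ = m≢0 refl
ℕtoℚ-≢0 {suc m} _   eq with trans (sym (ℕtoℚ≡fromℤ (suc m))) eq
... | ()

-- Also for q = 0ℚ, where both sides are 0ℚ.
÷'≡*1÷' : ∀ p q → p ÷' q ≡ p ℚ.* (1ℚ ÷' q)
÷'≡*1÷' p q with q ℚ.≟ 0ℚ
... | yes _ = sym (ℚ.*-zeroʳ p)
... | no q≢0 = cong (p ℚ.*_) (sym (ℚ.*-identityˡ _))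
  where instance _ = ℚ.≢-nonZero q≢0

*-1÷'-inverse : ∀ {q} → q ≢ 0ℚ → q ℚ.* (1ℚ ÷' q) ≡ 1ℚ
*-1÷'-inverse {q} q≢0 with q ℚ.≟ 0ℚ
... | yes q≡0 = ⊥-elim (q≢0 q≡0)
... | no q≢0′ = trans (cong (q ℚ.*_) (ℚ.*-identityˡ _)) (ℚ.*-inverseʳ q)
  where instance _ = ℚ.≢-nonZero q≢0′

*-÷'-cancelˡ : ∀ {p} q → p ≢ 0ℚ → (p ℚ.* q) ÷' p ≡ q
*-÷'-cancelˡ {p} q p≢0 = begin
  (p ℚ.* q) ÷' p           ≡⟨ ÷'≡*1÷' (p ℚ.* q) p ⟩
  p ℚ.* q ℚ.* (1ℚ ÷' p)    ≡⟨ cong (ℚ._* (1ℚ ÷' p)) (ℚ.*-comm p q) ⟩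
  q ℚ.* p ℚ.* (1ℚ ÷' p)    ≡⟨ ℚ.*-assoc q p _ ⟩
  q ℚ.* (p ℚ.* (1ℚ ÷' p))  ≡⟨ cong (q ℚ.*_) (*-1÷'-inverse p≢0) ⟩
  q ℚ.* 1ℚ                  ≡⟨ ℚ.*-identityʳ q ⟩
  q                          ∎
  where open ≡-Reasoning

open ListSum ℚ.+-0-isCommutativeMonoid using ()
  renaming (sum to sumℚ; sum-cong to sumℚ-cong; sum-ε to sumℚ-0; sum-single to sumℚ-single; sum-swap to sumℚ-swap)

𝟙 : Bool → ℚ
𝟙 b = if b then 1ℚ else 0ℚ

sumℚ-if : ∀ (p : A → Bool) c xs → sumℚ xs (λ x → if p x then c else 0ℚ) ≡ ℕtoℚ (count p xs) ℚ.* c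
sumℚ-if p c []       = sym (ℚ.*-zeroˡ c)
sumℚ-if p c (x ∷ xs) with p x
... | true  = begin
  c ℚ.+ sumℚ xs (λ y → if p y then c else 0ℚ) ≡⟨ cong (c ℚ.+_) (sumℚ-if p c xs) ⟩
  c ℚ.+ ℕtoℚ (count p xs) ℚ.* c               ≡⟨ cong (ℚ._+ ℕtoℚ (count p xs) ℚ.* c) (sym (ℚ.*-identityˡ c)) ⟩
  1ℚ ℚ.* c ℚ.+ ℕtoℚ (count p xs) ℚ.* c         ≡⟨ sym (ℚ.*-distribʳ-+ c 1ℚ (ℕtoℚ (count p xs))) ⟩
  (1ℚ ℚ.+ ℕtoℚ (count p xs)) ℚ.* c             ≡⟨ cong (ℚ._* c) (sym (ℕtoℚ-+ 1 (count p xs))) ⟩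
  ℕtoℚ (suc (count p xs)) ℚ.* c                ∎
  where open ≡-Reasoning
... | false = trans (ℚ.+-identityˡ _) (sumℚ-if p c xs)

sumℚ-guard : ∀ b (xs : List A) f → sumℚ xs (λ x → if b then f x else 0ℚ) ≡ (if b then sumℚ xs f else 0ℚ)
sumℚ-guard true  xs f = refl
sumℚ-guard false xs f = sumℚ-0 xs (λ _ _ → refl)

sumℚ-- : ∀ (xs : List A) f g → sumℚ xs (λ x → f x ℚ.- g x) ≡ sumℚ xs f ℚ.- sumℚ xs g
sumℚ-- []       f g = refl
sumℚ-- (x ∷ xs) f g = trans (cong ((f x ℚ.- g x) ℚ.+_) (sumℚ-- xs f g)) (lemma (f x) (g x) (sumℚ xs f) (sumℚ xs g))
  where
  open ℚSolver
  lemma : ∀ a b c d → (a ℚ.- b) ℚ.+ (c ℚ.- d) ≡ (a ℚ.+ c) ℚ.- (b ℚ.+ d)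
  lemma = solve 4 (λ a b c d → (a :- b) :+ (c :- d) := (a :+ c) :- (b :+ d)) refl

∑≤ : (ℕ → ℚ) → ℕ → ℚ
∑≤ f zero    = f 0
∑≤ f (suc d) = ∑≤ f d ℚ.+ f (suc d)

∏< : (ℕ → ℚ) → ℕ → ℚ
∏< f zero    = 1ℚ
∏< f (suc m) = ∏< f m ℚ.* f m

∑≤-cong : ∀ {f g} d → (∀ m → f m ≡ g m) → ∑≤ f d ≡ ∑≤ g d
∑≤-cong zero    eq = eq 0
∑≤-cong (suc d) eq = cong₂ ℚ._+_ (∑≤-cong d eq) (eq (suc d))

∑≤-*ˡ : ∀ c f d → ∑≤ (λ m → c ℚ.* f m) d ≡ c ℚ.* ∑≤ f d
∑≤-*ˡ c f zero    = refl
∑≤-*ˡ c f (suc d) = trans (cong (ℚ._+ c ℚ.* f (suc d)) (∑≤-*ˡ c f d)) (sym (ℚ.*-distribˡ-+ c _ _))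

∑≤-suc : ∀ f d → ∑≤ f (suc d) ≡ f 0 ℚ.+ ∑≤ (f ∘ suc) d
∑≤-suc f zero    = refl
∑≤-suc f (suc d) = trans (cong (ℚ._+ f (suc (suc d))) (∑≤-suc f d)) (ℚ.+-assoc (f 0) _ _)

module ℚ-* = CommutativeSemigroupProperties (CommutativeMonoid.commutativeSemigroup ℚ.*-1-commutativeMonoid)

∏<-* : ∀ f g m → ∏< (λ j → f j ℚ.* g j) m ≡ ∏< f m ℚ.* ∏< g m
∏<-* f g zero    = refl
∏<-* f g (suc m) = trans (cong (ℚ._* (f m ℚ.* g m)) (∏<-* f g m)) (ℚ-*.interchange (∏< f m) (∏< g m) (f m) (g m))

horner : (c x : ℕ → ℚ) → ℕ → ℕ → ℚ
horner c x zero    i = c i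
horner c x (suc d) i = c i ℚ.- x i ℚ.* horner c x d (suc i)

horner-expansion : ∀ c x d → horner c x d 0 ≡ ∑≤ (λ m → ∏< (λ j → ℚ.- x j) m ℚ.* c m) d
horner-expansion c x d = trans (sym (ℚ.*-identityˡ _)) (shifted d 0)
  where
  w : ℕ → ℚ
  w = ∏< (λ j → ℚ.- x j)
  shifted : ∀ d i → w i ℚ.* horner c x d i ≡ ∑≤ (λ m → w (i ℕ.+ m) ℚ.* c (i ℕ.+ m)) d
  shifted zero    i = cong (λ j → w j ℚ.* c j) (sym (ℕ.+-identityʳ i))
  shifted (suc d) i = begin
    w i ℚ.* (c i ℚ.- x i ℚ.* horner c x d (suc i))
      ≡⟨ lemma (w i) (c i) (x i) (horner c x d (suc i)) ⟩
    w i ℚ.* c i ℚ.+ w (suc i) ℚ.* horner c x d (suc i)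
      ≡⟨ cong₂ ℚ._+_ (cong (λ j → w j ℚ.* c j) (sym (ℕ.+-identityʳ i))) (shifted d (suc i)) ⟩
    w (i ℕ.+ 0) ℚ.* c (i ℕ.+ 0) ℚ.+ ∑≤ (λ m → w (suc i ℕ.+ m) ℚ.* c (suc i ℕ.+ m)) d
      ≡⟨ cong (w (i ℕ.+ 0) ℚ.* c (i ℕ.+ 0) ℚ.+_)
           (∑≤-cong d (λ m → cong (λ j → w j ℚ.* c j) (sym (ℕ.+-suc i m)))) ⟩
    w (i ℕ.+ 0) ℚ.* c (i ℕ.+ 0) ℚ.+ ∑≤ (λ m → w (i ℕ.+ suc m) ℚ.* c (i ℕ.+ suc m)) d
      ≡⟨ sym (∑≤-suc (λ m → w (i ℕ.+ m) ℚ.* c (i ℕ.+ m)) d) ⟩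
    ∑≤ (λ m → w (i ℕ.+ m) ℚ.* c (i ℕ.+ m)) (suc d) ∎
    where
    open ≡-Reasoning
    open ℚSolver
    lemma : ∀ w c x h → w ℚ.* (c ℚ.- x ℚ.* h) ≡ w ℚ.* c ℚ.+ w ℚ.* (ℚ.- x) ℚ.* h
    lemma = solve 4 (λ w c x h → w :* (c :- x :* h) := w :* c :+ w :* (:- x) :* h) refl

sumTerm≡∑≤ : ∀ a d → sumTerm a d ≡ ∑≤ (prodTerm a) d
sumTerm≡∑≤ a zero    = refl
sumTerm≡∑≤ a (suc d) = cong (ℚ._+ prodTerm a (suc d)) (sumTerm≡∑≤ a d)

module _ (a : ℕ → ℕ) where

  private
    aℚ : ℕ → ℚ
    aℚ j = ℕtoℚ (a j)

  gapInverses : ℕ → ℚ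
  gapInverses = ∏< (λ j → 1ℚ ÷' (aℚ 0 ℚ.- aℚ (suc j)))

  prodTerm≡∏<-neg*gapInverses : ∀ m → prodTerm a m ≡ ∏< (λ j → ℚ.- aℚ (suc j)) m ℚ.* gapInverses m
  prodTerm≡∏<-neg*gapInverses m = trans (as-∏< m) (∏<-* (λ j → ℚ.- aℚ (suc j)) _ m)
    where
    as-∏< : ∀ m → prodTerm a m ≡ ∏< (λ j → (ℚ.- aℚ (suc j)) ℚ.* (1ℚ ÷' (aℚ 0 ℚ.- aℚ (suc j)))) m
    as-∏< zero    = refl
    as-∏< (suc m) = cong₂ ℚ._*_ (as-∏< m) (÷'≡*1÷' (ℚ.- aℚ (suc m)) (aℚ 0 ℚ.- aℚ (suc m)))

  ∏<-neg-shift : ∀ m → ∏< (λ j → ℚ.- aℚ j) m ℚ.* aℚ m ≡ ∏< (λ j → ℚ.- aℚ (suc j)) m ℚ.* aℚ 0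
  ∏<-neg-shift zero    = refl
  ∏<-neg-shift (suc m) = begin
    (∏< (λ j → ℚ.- aℚ j) m ℚ.* ℚ.- aℚ m) ℚ.* aℚ (suc m)
      ≡⟨ lemma₁ (∏< (λ j → ℚ.- aℚ j) m) (aℚ m) (aℚ (suc m)) ⟩
    ℚ.- (∏< (λ j → ℚ.- aℚ j) m ℚ.* aℚ m) ℚ.* aℚ (suc m)
      ≡⟨ cong (λ p → ℚ.- p ℚ.* aℚ (suc m)) (∏<-neg-shift m) ⟩
    ℚ.- (∏< (λ j → ℚ.- aℚ (suc j)) m ℚ.* aℚ 0) ℚ.* aℚ (suc m)
      ≡⟨ lemma₂ (∏< (λ j → ℚ.- aℚ (suc j)) m) (aℚ 0) (aℚ (suc m)) ⟩
    (∏< (λ j → ℚ.- aℚ (suc j)) m ℚ.* ℚ.- aℚ (suc m)) ℚ.* aℚ 0 ∎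
    where
    open ≡-Reasoning
    open ℚSolver
    lemma₁ : ∀ w x y → (w ℚ.* ℚ.- x) ℚ.* y ≡ ℚ.- (w ℚ.* x) ℚ.* y
    lemma₁ = solve 3 (λ w x y → (w :* :- x) :* y := :- (w :* x) :* y) refl
    lemma₂ : ∀ q x₀ y → ℚ.- (q ℚ.* x₀) ℚ.* y ≡ (q ℚ.* ℚ.- y) ℚ.* x₀
    lemma₂ = solve 3 (λ q x₀ y → :- (q :* x₀) :* y := (q :* :- y) :* x₀) refl

  weight*term≡prodTerm : ∀ K m →
    ∏< (λ j → ℚ.- aℚ j) m ℚ.* (aℚ m ℚ.* K ℚ.* gapInverses m) ≡ aℚ 0 ℚ.* K ℚ.* prodTerm a m
  weight*term≡prodTerm K m = begin
    w ℚ.* (aℚ m ℚ.* K ℚ.* gapInverses m)          ≡⟨ lemma₁ w (aℚ m) K (gapInverses m) ⟩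
    (w ℚ.* aℚ m) ℚ.* K ℚ.* gapInverses m          ≡⟨ cong (λ p → p ℚ.* K ℚ.* gapInverses m) (∏<-neg-shift m) ⟩
    (q ℚ.* aℚ 0) ℚ.* K ℚ.* gapInverses m          ≡⟨ lemma₂ q (aℚ 0) K (gapInverses m) ⟩
    aℚ 0 ℚ.* K ℚ.* (q ℚ.* gapInverses m)          ≡⟨ cong (aℚ 0 ℚ.* K ℚ.*_) (sym (prodTerm≡∏<-neg*gapInverses m)) ⟩
    aℚ 0 ℚ.* K ℚ.* prodTerm a m                    ∎
    where
    open ≡-Reasoning
    open ℚSolver
    w = ∏< (λ j → ℚ.- aℚ j) m
    q = ∏< (λ j → ℚ.- aℚ (suc j)) m
    lemma₁ : ∀ w x K r → w ℚ.* (x ℚ.* K ℚ.* r) ≡ (w ℚ.* x) ℚ.* K ℚ.* r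
    lemma₁ = solve 4 (λ w x K r → w :* (x :* K :* r) := (w :* x) :* K :* r) refl
    lemma₂ : ∀ q x K r → (q ℚ.* x) ℚ.* K ℚ.* r ≡ x ℚ.* K ℚ.* (q ℚ.* r)
    lemma₂ = solve 4 (λ q x K r → (q :* x) :* K :* r := x :* K :* (q :* r)) refl

firstIn : (A → Bool) → List A → Maybe A
firstIn S []       = nothing
firstIn S (y ∷ ys) = if S y then just y else firstIn S ys

firstIn-nothing : ∀ (S : A → Bool) π → firstIn S π ≡ nothing → ∀ {y} → y ∈ π → S y ≡ false
firstIn-nothing S (z ∷ π) eq y∈ with S z in Sz
firstIn-nothing S (z ∷ π) () y∈          | true
firstIn-nothing S (z ∷ π) eq (here refl) | false = Sz
firstIn-nothing S (z ∷ π) eq (there y∈)  | false = firstIn-nothing S π eq y∈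

module _ {n : ℕ} where

  _==_ : Fin n → Fin n → Bool
  x == y = does (x Fin.≟ y)

  ==-refl : ∀ x → x == x ≡ true
  ==-refl x = Dec.dec-true (x Fin.≟ x) refl

  ≢⇒==-false : ∀ {x y} → x ≢ y → x == y ≡ false
  ≢⇒==-false {x} {y} = Dec.dec-false (x Fin.≟ y)

  not-==⇒≢ : ∀ {x y} → not (x == y) ≡ true → x ≢ y
  not-==⇒≢ {x} eq refl rewrite ==-refl x = case eq of λ ()

  position : List (Fin n) → Fin n → ℕ
  position []       x = 0
  position (y ∷ ys) x = if y == x then 0 else suc (position ys x)

  position-here : ∀ y ys → position (y ∷ ys) y ≡ 0
  position-here y ys rewrite ==-refl y = refl

  position-there : ∀ {y x} ys → y ≢ x → position (y ∷ ys) x ≡ suc (position ys x)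
  position-there ys y≢x rewrite ≢⇒==-false y≢x = refl

  position-injective : ∀ π {x y} → x ∈ π → y ∈ π → position π x ≡ position π y → x ≡ y
  position-injective (z ∷ π) {x} {y} x∈ y∈ eq with z Fin.≟ x | z Fin.≟ y
  ... | yes refl | yes refl = refl
  ... | yes _    | no _     = ⊥-elim (ℕ.0≢1+n eq)
  ... | no _     | yes _    = ⊥-elim (ℕ.0≢1+n (sym eq))
  ... | no z≢x   | no z≢y   with x∈ | y∈
  ...   | here refl | _         = ⊥-elim (z≢x refl)
  ...   | _         | here refl = ⊥-elim (z≢y refl)
  ...   | there x∈π | there y∈π = position-injective π x∈π y∈π (ℕ.suc-injective eq)

  position-≤∧≢⇒< : ∀ π {x y} → x ∈ π → y ∈ π → x ≢ y →
                   position π x ≤ position π y → position π x < position π y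
  position-≤∧≢⇒< π x∈ y∈ x≢y x≤y = ℕ.≤∧≢⇒< x≤y (x≢y ∘ position-injective π x∈ y∈)

  ∈-take⇒position< : ∀ i π {x} → x ∈ take i π → position π x < i
  ∈-take⇒position< (suc i) (z ∷ π) {x} x∈ with z Fin.≟ x | x∈
  ... | yes _  | _          = s≤s z≤n
  ... | no z≢x | here refl  = ⊥-elim (z≢x refl)
  ... | no _   | there x∈π  = s≤s (∈-take⇒position< i π x∈π)

  ∈-take⁻ : ∀ i (π : List (Fin n)) {x} → x ∈ take i π → x ∈ π
  ∈-take⁻ (suc i) (z ∷ π) (here refl) = here refl
  ∈-take⁻ (suc i) (z ∷ π) (there x∈)  = there (∈-take⁻ i π x∈)

  position<⇒∈-take : ∀ i π {x} → x ∈ π → position π x < i → x ∈ take i π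
  position<⇒∈-take (suc i) (z ∷ π) {x} x∈ lt with z Fin.≟ x | x∈
  ... | yes refl | _         = here refl
  ... | no z≢x   | here refl = ⊥-elim (z≢x refl)
  ... | no _     | there x∈π = there (position<⇒∈-take i π x∈π (ℕ.≤-pred lt))

  Earliest : (Fin n → Bool) → List (Fin n) → Fin n → Set
  Earliest S π x = x ∈ π × S x ≡ true × (∀ {y} → y ∈ π → S y ≡ true → position π x ≤ position π y)

  firstIn⇒Earliest : ∀ S π {x} → firstIn S π ≡ just x → Earliest S π x
  firstIn⇒Earliest S (y ∷ π) eq with S y in Sy
  firstIn⇒Earliest S (y ∷ π) refl | true  =
    here refl , Sy , λ _ _ → ℕ.≤-trans (ℕ.≤-reflexive (position-here y π)) z≤n
  firstIn⇒Earliest S (y ∷ π) {x} eq | false with firstIn⇒Earliest S π eq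
  ... | x∈ , Sx , minimal = there x∈ , Sx , later
    where
    y≢ : ∀ {z} → S z ≡ true → y ≢ z
    y≢ Sz refl = not-¬ Sz Sy
    later : ∀ {z} → z ∈ y ∷ π → S z ≡ true → position (y ∷ π) x ≤ position (y ∷ π) z
    later (here refl) Sz = ⊥-elim (y≢ Sz refl)
    later (there z∈)  Sz rewrite position-there π (y≢ Sx) | position-there π (y≢ Sz) = s≤s (minimal z∈ Sz)

  Earliest⇒firstIn : ∀ S π {x} → Earliest S π x → firstIn S π ≡ just x
  Earliest⇒firstIn S (y ∷ π) {x} (x∈ , Sx , minimal) with S y in Sy
  ... | true with y Fin.≟ x
  ...   | yes refl = refl
  ...   | no _     = contradiction (ℕ.≤-trans (minimal (here refl) Sy) (ℕ.≤-reflexive (position-here y π))) λ ()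
  Earliest⇒firstIn S (y ∷ π) {x} (here refl , Sx , minimal) | false = ⊥-elim (not-¬ Sx Sy)
  Earliest⇒firstIn S (y ∷ π) {x} (there x∈ , Sx , minimal) | false =
    Earliest⇒firstIn S π (x∈ , Sx , λ z∈ Sz →
      ℕ.≤-pred (subst₂ _≤_ (position-there π (y≢ Sx)) (position-there π (y≢ Sz)) (minimal (there z∈) Sz)))
    where
    y≢ : ∀ {z} → S z ≡ true → y ≢ z
    y≢ Sz refl = not-¬ Sz Sy

  Earliest-⊆ : ∀ {S S′ : Fin n → Bool} {π x} → (∀ {v} → S v ≡ true → S′ v ≡ true) → S x ≡ true →
               Earliest S′ π x → Earliest S π x
  Earliest-⊆ S⊆S′ Sx (x∈ , _ , minimal) = x∈ , Sx , λ y∈ Sy → minimal y∈ (S⊆S′ Sy)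

  leads : (Fin n → Bool) → List (Fin n) → Fin n → Bool
  leads S π x = maybe (_== x) false (firstIn S π)

  leads⇒Earliest : ∀ S π {x} → leads S π x ≡ true → Earliest S π x
  leads⇒Earliest S π {x} eq with firstIn S π in first
  ... | just y with y Fin.≟ x
  ...   | yes refl = firstIn⇒Earliest S π first

  Earliest⇒leads : ∀ S π {x} → Earliest S π x → leads S π x ≡ true
  Earliest⇒leads S π {x} e rewrite Earliest⇒firstIn S π e = ==-refl x

  leads-∷-outside : ∀ S π {x y} → S x ≡ false → leads S (x ∷ π) y ≡ leads S π y
  leads-∷-outside S π Sx rewrite Sx = refl

  leads-∷-self : ∀ S π {x} → S x ≡ true → leads S (x ∷ π) x ≡ true
  leads-∷-self S π {x} Sx rewrite Sx = ==-refl x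


module GraphProperties {n : ℕ} (G : Graph n) where

  N[_] : List (Fin n) → Fin n → Bool
  N[ []    ] v = false
  N[ u ∷ I ] v = (u == v ∨ adj G u v) ∨ N[ I ] v

  N-self : ∀ x I → N[ x ∷ I ] x ≡ true
  N-self x I rewrite ==-refl x = refl

  N-there : ∀ x I {v} → N[ I ] v ≡ true → N[ x ∷ I ] v ≡ true
  N-there x I eq rewrite eq = ∨-zeroʳ _

  N-adj : ∀ x I {v} → adj G x v ≡ true → N[ x ∷ I ] v ≡ true
  N-adj x I {v} eq rewrite eq | ∨-zeroʳ (x == v) = refl

  N-tail : ∀ x I {v} → N[ x ∷ I ] v ≡ false → N[ I ] v ≡ false
  N-tail x I eq = ∨-conicalʳ _ _ eq

  N-∷-false : ∀ {x I v} → x ≢ v → adj G x v ≡ false → N[ I ] v ≡ false → N[ x ∷ I ] v ≡ false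
  N-∷-false x≢v x≁v v∉ rewrite ≢⇒==-false x≢v | x≁v | v∉ = refl

  N-∷⁻ : ∀ x I {v} → N[ x ∷ I ] v ≡ true → x ≡ v ⊎ adj G x v ≡ true ⊎ N[ I ] v ≡ true
  N-∷⁻ x I {v} eq with x Fin.≟ v | adj G x v
  ... | yes x≡v | _     = inj₁ x≡v
  ... | no _    | true  = inj₂ (inj₁ refl)
  ... | no _    | false = inj₂ (inj₂ eq)

  N-mono : ∀ x I {v} → N[ x ∷ [] ] v ≡ true → N[ x ∷ I ] v ≡ true
  N-mono x I eq with N-∷⁻ x [] eq
  ... | inj₁ refl        = N-self x I
  ... | inj₂ (inj₁ x~v) = N-adj x I x~v

  Stable : List (Fin n) → Set
  Stable []      = ⊤
  Stable (x ∷ I) = N[ I ] x ≡ false × Stable I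

  module _ {S : Fin n → Set} where

    Reach-prepend : ∀ {u w v} → T (adj G u w) → S u → Reach G S w v → Reach G S u v
    Reach-prepend u~w Su (here Sw)          = step (here Su) u~w Sw
    Reach-prepend u~w Su (step r w′~v Sv) = step (Reach-prepend u~w Su r) w′~v Sv

    Reach-reverse : ∀ {u v} → Reach G S u v → Reach G S v u
    Reach-reverse (here Su)              = here Su
    Reach-reverse (step {w} {v} r w~v Sv) = Reach-prepend (subst T (Graph.sym G w v) w~v) Sv (Reach-reverse r)

    Reach-target : ∀ {u v} → Reach G S u v → S v
    Reach-target (here Su)     = Su
    Reach-target (step _ _ Sv) = Sv

    Reach-trans : ∀ {u w v} → Reach G S u w → Reach G S w v → Reach G S u v
    Reach-trans r (here _)          = r
    Reach-trans r (step r′ w~v Sv) = step (Reach-trans r r′) w~v Sv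

  locallyFirst : List (Fin n) → Fin n → Bool
  locallyFirst π v = leads N[ v ∷ [] ] π v

  lateLocalMin : List (Fin n) → Maybe (Fin n)
  lateLocalMin []      = nothing
  lateLocalMin (f ∷ r) = firstIn (λ v → locallyFirst (f ∷ r) v ∧ not (f == v)) (f ∷ r)

  successiveᵇ : List (Fin n) → Bool
  successiveᵇ π = is-nothing (lateLocalMin π)

  locallyFirst⇒head : ∀ f r {x} → lateLocalMin (f ∷ r) ≡ nothing → locallyFirst (f ∷ r) x ≡ true → f ≡ x
  locallyFirst⇒head f r {x} none x-first with f Fin.≟ x
  ... | yes f≡x = f≡x
  ... | no f≢x  = ⊥-elim (not-¬ (cong₂ _∧_ x-first (cong not (≢⇒==-false f≢x)))
                    (firstIn-nothing _ (f ∷ r) none (proj₁ (leads⇒Earliest N[ x ∷ [] ] (f ∷ r) x-first))))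

  locallyFirst⇒nonadjacent-before : ∀ π {v u} → locallyFirst π v ≡ true → u ∈ π →
    position π u < position π v → adj G v u ≡ false
  locallyFirst⇒nonadjacent-before π {v} {u} first u∈ u<v with adj G v u in v~u
  ... | false = refl
  ... | true  = contradiction (proj₂ (proj₂ (leads⇒Earliest N[ v ∷ [] ] π first)) u∈ (N-adj v [] v~u)) (ℕ.<⇒≱ u<v)

  successive⇒successiveᵇ : ∀ π → Successive G π → successiveᵇ π ≡ true
  successive⇒successiveᵇ []      _         = refl
  successive⇒successiveᵇ (f ∷ r) connected with lateLocalMin (f ∷ r) in late
  ... | nothing = refl
  ... | just b  = ⊥-elim (unreachable (connected (suc (position π b)) (s≤s z≤n) f b (here refl)
                                         (position<⇒∈-take _ π b∈ (ℕ.n<1+n _))))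
    where
    π = f ∷ r
    Prefix = λ v → v ∈ take (suc (position π b)) π
    earliest = firstIn⇒Earliest _ π late
    b∈ = proj₁ earliest
    b-first : locallyFirst π b ≡ true
    b-first = ∧-conicalˡ _ _ (proj₁ (proj₂ earliest))
    f≢b : f ≢ b
    f≢b = not-==⇒≢ (∧-conicalʳ _ _ (proj₁ (proj₂ earliest)))
    unreachable : Reach G Prefix f b → ⊥
    unreachable (here _)           = f≢b refl
    unreachable (step {w} r w~b _) =
      not-¬ (trans (Graph.sym G b w) w~b′) (locallyFirst⇒nonadjacent-before π b-first w∈ w<b)
      where
      w~b′ = Equivalence.to T-≡ w~b
      w-prefix = Reach-target r
      w∈ = ∈-take⁻ _ π w-prefix
      w≢b : w ≢ b
      w≢b refl = not-¬ w~b′ (irrefl G w)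
      w<b : position π w < position π b
      w<b = position-≤∧≢⇒< π w∈ b∈ w≢b (ℕ.≤-pred (∈-take⇒position< _ π w-prefix))

  successiveᵇ⇒successive : ∀ π → successiveᵇ π ≡ true → Successive G π
  successiveᵇ⇒successive []      _ zero    _ _ _ ()
  successiveᵇ⇒successive []      _ (suc i) _ _ _ ()
  successiveᵇ⇒successive (f ∷ r) _ with lateLocalMin (f ∷ r) in late
  ... | nothing = λ i _ u v u∈ v∈ →
    Reach-trans (Reach-reverse (from-head i _ u∈ (ℕ.n<1+n _))) (from-head i _ v∈ (ℕ.n<1+n _))
    where
    π = f ∷ r
    from-head : ∀ i k {x} → x ∈ take i π → position π x < k → Reach G (λ v → v ∈ take i π) f x
    from-head i (suc k) {x} x-prefix x<k with f Fin.≟ x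
    ... | yes refl = here x-prefix
    ... | no f≢x with firstIn N[ x ∷ [] ] π in first
    ...   | nothing = ⊥-elim (not-¬ (N-self x []) (firstIn-nothing _ π first x∈))
      where x∈ = ∈-take⁻ i π x-prefix
    ...   | just z  = step (from-head i k z-prefix (ℕ.<-≤-trans z<x x≤k)) (Equivalence.from T-≡ z~x) x-prefix
      where
      x∈ = ∈-take⁻ i π x-prefix
      x≤k : position π x ≤ k
      x≤k = ℕ.≤-pred (subst (_< suc k) (sym (position-there r f≢x)) x<k)
      earliest = firstIn⇒Earliest _ π first
      z≢x : z ≢ x
      z≢x refl = f≢x (locallyFirst⇒head f r late (Earliest⇒leads _ π earliest))
      z~x : adj G z x ≡ true
      z~x with N-∷⁻ x [] (proj₁ (proj₂ earliest))
      ... | inj₁ x≡z        = ⊥-elim (z≢x (sym x≡z))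
      ... | inj₂ (inj₁ x~z) = trans (Graph.sym G z x) x~z
      ... | inj₂ (inj₂ ())
      z<x : position π z < position π x
      z<x = position-≤∧≢⇒< π (proj₁ earliest) x∈ z≢x (proj₂ (proj₂ earliest) x∈ (N-self x []))
      z-prefix = position<⇒∈-take i π (proj₁ earliest) (ℕ.<-trans z<x (∈-take⇒position< i π x-prefix))

  leadsChain : List (Fin n) → List (Fin n) → Bool
  leadsChain π []      = true
  leadsChain π (x ∷ I) = leads N[ x ∷ I ] π x ∧ leadsChain π I

  headOutside : List (Fin n) → List (Fin n) → Bool
  headOutside []      I = true
  headOutside (f ∷ _) I = not (N[ I ] f)

  -- The sum, over stable chains J extending I by at most d vertices, of (−1)^(|J| − |I|) times
  -- the indicator that π leads J and starts outside N[ J ].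
  chainSum : List (Fin n) → ℕ → List (Fin n) → ℚ
  chainSum π zero    I = 𝟙 (leadsChain π I ∧ headOutside π I)
  chainSum π (suc d) I = 𝟙 (leadsChain π I ∧ headOutside π I)
    ℚ.- sumℚ (allFin n) (λ x → if not (N[ I ] x) then chainSum π d (x ∷ I) else 0ℚ)

  chainSum-suc≡0 : ∀ π d I → leadsChain π I ∧ headOutside π I ≡ false →
    (∀ x → N[ I ] x ≡ false → chainSum π d (x ∷ I) ≡ 0ℚ) → chainSum π (suc d) I ≡ 0ℚ
  chainSum-suc≡0 π d I head≡false child≡0 rewrite head≡false =
    cong (λ s → 0ℚ ℚ.- s) (sumℚ-0 (allFin n) λ x _ → child x (N[ I ] x) refl)
    where
    child : ∀ x b → N[ I ] x ≡ b → (if not b then chainSum π d (x ∷ I) else 0ℚ) ≡ 0ℚ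
    child x true  _  = refl
    child x false x∉ = child≡0 x x∉

  chainSum-unled : ∀ π d I → leadsChain π I ≡ false → chainSum π d I ≡ 0ℚ
  chainSum-unled π zero    I unled rewrite unled = refl
  chainSum-unled π (suc d) I unled = chainSum-suc≡0 π d I (cong (_∧ headOutside π I) unled)
    (λ x _ → chainSum-unled π d (x ∷ I) (trans (cong (leads N[ x ∷ I ] π x ∧_) unled) (∧-zeroʳ _)))

  chainSum-head∈N : ∀ f r d I → N[ I ] f ≡ true → chainSum (f ∷ r) d I ≡ 0ℚ
  chainSum-head∈N f r zero    I f∈N rewrite f∈N | ∧-zeroʳ (leadsChain (f ∷ r) I) = refl
  chainSum-head∈N f r (suc d) I f∈N =
    chainSum-suc≡0 (f ∷ r) d I (trans (cong (λ b → leadsChain (f ∷ r) I ∧ not b) f∈N) (∧-zeroʳ _))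
    (λ x _ → chainSum-head∈N f r d (x ∷ I) (N-there x I f∈N))

  leads⇒locallyFirst : ∀ π {x} J → leads N[ x ∷ J ] π x ≡ true → locallyFirst π x ≡ true
  leads⇒locallyFirst π {x} J first =
    Earliest⇒leads _ π (Earliest-⊆ (N-mono x J) (N-self x []) (leads⇒Earliest _ π first))

  chainSum-successive : ∀ f r d → lateLocalMin (f ∷ r) ≡ nothing → chainSum (f ∷ r) d [] ≡ 1ℚ
  chainSum-successive f r zero    _    = refl
  chainSum-successive f r (suc d) none =
    cong (λ s → 1ℚ ℚ.- s) (sumℚ-0 (allFin n) (λ x _ → child x))
    where
    π = f ∷ r
    child : ∀ x → chainSum π d (x ∷ []) ≡ 0ℚ
    child x with f Fin.≟ x
    ... | yes refl = chainSum-head∈N f r d (f ∷ []) (N-self f [])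
    ... | no f≢x   = chainSum-unled π d (x ∷ []) (trans (∧-identityʳ _) not-first)
      where
      not-first : locallyFirst π x ≡ false
      not-first with locallyFirst π x in x-first
      ... | false = refl
      ... | true  = ⊥-elim (f≢x (locallyFirst⇒head f r none x-first))

  -- For b the earliest locally first vertex after the head f, the child b ∷ I of a chain I
  -- satisfying Invariant contributes exactly the head term of I, and every other child vanishes.
  module NonSuccessive (f : Fin n) (r : List (Fin n)) {b : Fin n} (late : lateLocalMin (f ∷ r) ≡ just b)
                       (α : ℕ) (bound : ∀ J → Stable J → length J ≤ α) where

    private
      π = f ∷ r
      earliest = firstIn⇒Earliest _ π late

      b∈ : b ∈ π
      b∈ = proj₁ earliest

      b-first : locallyFirst π b ≡ true
      b-first = ∧-conicalˡ _ _ (proj₁ (proj₂ earliest))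

      f≢b : f ≢ b
      f≢b = not-==⇒≢ (∧-conicalʳ _ _ (proj₁ (proj₂ earliest)))

      b-minimal : ∀ {y} → y ∈ π → locallyFirst π y ≡ true → f ≢ y → position π b ≤ position π y
      b-minimal y∈ y-first f≢y = proj₂ (proj₂ earliest) y∈ (cong₂ _∧_ y-first (cong not (≢⇒==-false f≢y)))

      f-before : ∀ {x} → x ∈ π → f ≢ x → position π f < position π x
      f-before x∈ f≢x =
        position-≤∧≢⇒< π (here refl) x∈ f≢x (ℕ.≤-trans (ℕ.≤-reflexive (position-here f r)) z≤n)

      b≁f : adj G b f ≡ false
      b≁f = locallyFirst⇒nonadjacent-before π b-first (here refl) (f-before b∈ f≢b)

      b-before : ∀ {x} → x ∈ π → locallyFirst π x ≡ true → f ≢ x → x ≢ b → position π b < position π x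
      b-before x∈ x-first f≢x x≢b = position-≤∧≢⇒< π b∈ x∈ (x≢b ∘ sym) (b-minimal x∈ x-first f≢x)

    Invariant : List (Fin n) → Set
    Invariant I = Stable I × leadsChain π I ≡ true × N[ I ] b ≡ false × N[ I ] f ≡ false
                × (∀ {y} → y ∈ π → N[ I ] y ≡ true → position π b < position π y)

    invariant-step : ∀ {I x} → Invariant I → N[ I ] x ≡ false → f ≢ x → x ≢ b → leadsChain π (x ∷ I) ≡ true →
                     Invariant (x ∷ I)
    invariant-step {I} {x} (stable , led , b∉ , f∉ , after) x∉ f≢x x≢b x∷I-led =
      (x∉ , stable) , x∷I-led ,
      N-∷-false {x} {I} x≢b (locallyFirst⇒nonadjacent-before π x-first b∈ b<x) b∉ ,
      N-∷-false {x} {I} (f≢x ∘ sym) (locallyFirst⇒nonadjacent-before π x-first (here refl) (f-before x∈ f≢x)) f∉ ,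
      λ y∈ y∈N → ℕ.<-≤-trans b<x (x-minimal y∈ y∈N)
      where
      x-leads : leads N[ x ∷ I ] π x ≡ true
      x-leads = ∧-conicalˡ _ _ x∷I-led
      x∈ = proj₁ (leads⇒Earliest N[ x ∷ I ] π x-leads)
      x-minimal = proj₂ (proj₂ (leads⇒Earliest N[ x ∷ I ] π x-leads))
      x-first = leads⇒locallyFirst π {x} I x-leads
      b<x = b-before x∈ x-first f≢x x≢b

    b-leads : ∀ {I} → Invariant I → leads N[ b ∷ I ] π b ≡ true
    b-leads {I} (_ , _ , _ , _ , after) = Earliest⇒leads _ π (b∈ , N-self b I , minimal)
      where
      minimal : ∀ {z} → z ∈ π → N[ b ∷ I ] z ≡ true → position π b ≤ position π z
      minimal z∈ z∈N with N-∷⁻ b I z∈N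
      ... | inj₁ refl        = ℕ.≤-refl
      ... | inj₂ (inj₁ b~z) = proj₂ (proj₂ (leads⇒Earliest N[ b ∷ [] ] π b-first)) z∈ (N-adj b [] b~z)
      ... | inj₂ (inj₂ z∈I) = ℕ.<⇒≤ (after z∈ z∈I)

    b-head : ∀ {I} → Invariant I → leadsChain π (b ∷ I) ∧ headOutside π (b ∷ I) ≡ true
    b-head {I} inv@(_ , led , _ , f∉ , _) =
      cong₂ _∧_ (cong₂ _∧_ (b-leads inv) led) (cong not (N-∷-false {b} {I} (f≢b ∘ sym) b≁f f∉))

    chainSum-b : ∀ d {I} → Invariant I → chainSum π d (b ∷ I) ≡ 1ℚ
    chainSum-b zero    inv rewrite b-head inv = refl
    chainSum-b (suc d) {I} inv rewrite b-head inv =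
      cong (λ s → 1ℚ ℚ.- s) (sumℚ-0 (allFin n) (λ y _ → child y (N[ b ∷ I ] y) refl))
      where
      child : ∀ y c → N[ b ∷ I ] y ≡ c → (if not c then chainSum π d (y ∷ b ∷ I) else 0ℚ) ≡ 0ℚ
      child y true  _  = refl
      child y false y∉ with f Fin.≟ y
      ... | yes refl = chainSum-head∈N f r d (f ∷ b ∷ I) (N-self f (b ∷ I))
      ... | no f≢y   = chainSum-unled π d (y ∷ b ∷ I) unled
        where
        unled : leadsChain π (y ∷ b ∷ I) ≡ false
        unled with leads N[ y ∷ b ∷ I ] π y in y-leads
        ... | false = refl
        ... | true  = ⊥-elim (not-¬ (N-self b I) (subst (λ z → N[ b ∷ I ] z ≡ false) y≡b y∉))
          where
          y-earliest = leads⇒Earliest N[ y ∷ b ∷ I ] π y-leads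
          y≡b = position-injective π (proj₁ y-earliest) b∈ (ℕ.≤-antisym
                  (proj₂ (proj₂ y-earliest) b∈ (N-there y (b ∷ I) (N-self b I)))
                  (b-minimal (proj₁ y-earliest) (leads⇒locallyFirst π {y} (b ∷ I) y-leads) f≢y))

    chainSum-invariant : ∀ d {I} → Invariant I → length I ℕ.+ d ≡ α → chainSum π d I ≡ 0ℚ
    chainSum-invariant zero {I} (stable , _ , b∉ , _) len =
      ⊥-elim (ℕ.<-irrefl (trans (sym (ℕ.+-identityʳ _)) len) (bound (b ∷ I) (b∉ , stable)))
    chainSum-invariant (suc d) {I} inv@(_ , led , b∉ , f∉ , _) len rewrite led | f∉ =
      cong (λ s → 1ℚ ℚ.- s) (trans (sumℚ-single (Unique.allFin⁺ n) (∈.∈-allFin b) others) b-child)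
      where
      b-child : (if not (N[ I ] b) then chainSum π d (b ∷ I) else 0ℚ) ≡ 1ℚ
      b-child rewrite b∉ = chainSum-b d inv
      others : ∀ x → x ≢ b → (if not (N[ I ] x) then chainSum π d (x ∷ I) else 0ℚ) ≡ 0ℚ
      others x x≢b with N[ I ] x in x∉
      ... | true  = refl
      ... | false with f Fin.≟ x
      ...   | yes refl = chainSum-head∈N f r d (f ∷ I) (N-self f I)
      ...   | no f≢x with leadsChain π (x ∷ I) in x-led
      ...     | false = chainSum-unled π d (x ∷ I) x-led
      ...     | true  = chainSum-invariant d (invariant-step inv x∉ f≢x x≢b x-led) (trans (sym (ℕ.+-suc _ d)) len)

    chainSum≡0 : chainSum π α [] ≡ 0ℚ
    chainSum≡0 = chainSum-invariant α (tt , refl , refl , refl , λ _ ()) refl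

  chainSum≡𝟙successiveᵇ : ∀ α → (∀ J → Stable J → length J ≤ α) → ∀ π →
                          chainSum π α [] ≡ 𝟙 (successiveᵇ π)
  chainSum≡𝟙successiveᵇ zero    _     []      = refl
  chainSum≡𝟙successiveᵇ (suc d) _     []      =
    cong (λ s → 1ℚ ℚ.- s) (sumℚ-0 (allFin n) (λ x _ → chainSum-unled [] d (x ∷ []) refl))
  chainSum≡𝟙successiveᵇ α       bound (f ∷ r) with lateLocalMin (f ∷ r) in late
  ... | nothing = chainSum-successive f r α late
  ... | just _  = NonSuccessive.chainSum≡0 f r late α bound

  open Orderings (Fin._≟_ {n})

  private
    length-allFin : length (allFin n) ≡ n
    length-allFin = List.length-tabulate (λ x → x)

  allOrderings : List (List (Fin n))
  allOrderings = orderings n (allFin n)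

  IsOrdering⇔∈-allOrderings : ∀ {π} → IsOrdering G π ⇔ π ∈ allOrderings
  IsOrdering⇔∈-allOrderings = mk⇔
    (λ (_ , π-unique , all∈) → ∈-orderings⁺ n (Unique.allFin⁺ n) length-allFin π-unique
                                 (λ {v} → mk⇔ (λ _ → ∈.∈-allFin v) (λ _ → all∈ v)))
    (λ π∈ → let π-unique , π≈ = ∈-orderings⁻ n (Unique.allFin⁺ n) length-allFin π∈ in
      trans (unique-length π-unique (Unique.allFin⁺ n) π≈) length-allFin , π-unique ,
      λ v → Equivalence.from π≈ (∈.∈-allFin v))

  count-successive : ∀ s → HasCount (SuccessiveOrdering G) s → s ≡ count successiveᵇ allOrderings
  count-successive s (L , L-unique , refl , L≈) =
    trans (unique-length L-unique (Unique.filter⁺ successive? (orderings-unique n (Unique.allFin⁺ n))) (mk⇔ to from))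
          (length-filter-T? successiveᵇ allOrderings)
    where
    successive? = λ π → T? (successiveᵇ π)
    to : ∀ {π} → π ∈ L → π ∈ filter successive? allOrderings
    to {π} π∈ with Equivalence.to (L≈ π) π∈
    ... | ordering , connected = ∈.∈-filter⁺ successive? (Equivalence.to IsOrdering⇔∈-allOrderings ordering)
                                   (Equivalence.from T-≡ (successive⇒successiveᵇ _ connected))
    from : ∀ {π} → π ∈ filter successive? allOrderings → π ∈ L
    from {π} π∈ with ∈.∈-filter⁻ successive? π∈
    ... | π∈orderings , ok = Equivalence.from (L≈ π) (Equivalence.from IsOrdering⇔∈-allOrderings π∈orderings ,
                               successiveᵇ⇒successive _ (Equivalence.to T-≡ ok))

  ledCount : List (Fin n) → ℕ
  ledCount I = count (λ π → leadsChain π I ∧ headOutside π I) allOrderings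

  total : ℕ → List (Fin n) → ℚ
  total d I = sumℚ allOrderings (λ π → chainSum π d I)

  total-zero : ∀ I → total 0 I ≡ ℕtoℚ (ledCount I)
  total-zero I = trans (sumℚ-if (λ π → leadsChain π I ∧ headOutside π I) 1ℚ allOrderings) (ℚ.*-identityʳ _)

  total-suc : ∀ d I → total (suc d) I ≡
    ℕtoℚ (ledCount I) ℚ.- sumℚ (allFin n) (λ x → if not (N[ I ] x) then total d (x ∷ I) else 0ℚ)
  total-suc d I = begin
    sumℚ allOrderings (λ π → 𝟙 (leadsChain π I ∧ headOutside π I) ℚ.- sumℚ (allFin n) (child π))
      ≡⟨ sumℚ-- allOrderings _ _ ⟩
    sumℚ allOrderings (λ π → 𝟙 (leadsChain π I ∧ headOutside π I))
      ℚ.- sumℚ allOrderings (λ π → sumℚ (allFin n) (child π))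
      ≡⟨ cong₂ ℚ._-_ (total-zero I) (sumℚ-swap allOrderings (allFin n) child) ⟩
    ℕtoℚ (ledCount I) ℚ.- sumℚ (allFin n) (λ x → sumℚ allOrderings (λ π → child π x))
      ≡⟨ cong (λ s → ℕtoℚ (ledCount I) ℚ.- s) (sumℚ-cong (allFin n) (λ x _ →
           sumℚ-guard (not (N[ I ] x)) allOrderings (λ π → chainSum π d (x ∷ I)))) ⟩
    ℕtoℚ (ledCount I) ℚ.- sumℚ (allFin n) (λ x → if not (N[ I ] x) then total d (x ∷ I) else 0ℚ) ∎
    where
    open ≡-Reasoning
    child : List (Fin n) → Fin n → ℚ
    child π x = if not (N[ I ] x) then chainSum π d (x ∷ I) else 0ℚ

  nbhdProduct : List (Fin n) → List (Fin n) → ℕ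
  nbhdProduct U []      = 1
  nbhdProduct U (x ∷ I) = count N[ x ∷ I ] U ℕ.* nbhdProduct U I

  nbhdProduct-∖ : ∀ U {x} I → N[ I ] x ≡ false → nbhdProduct (U ∖ x) I ≡ nbhdProduct U I
  nbhdProduct-∖ U []      _  = refl
  nbhdProduct-∖ U (y ∷ I) x∉ = cong₂ ℕ._*_ (count-∖ N[ y ∷ I ] U x∉) (nbhdProduct-∖ U I (N-tail y I x∉))

  leadsChain-∷-outside : ∀ π {x} I → N[ I ] x ≡ false → leadsChain (x ∷ π) I ≡ leadsChain π I
  leadsChain-∷-outside π []      _  = refl
  leadsChain-∷-outside π (y ∷ I) x∉ =
    cong₂ _∧_ (leads-∷-outside N[ y ∷ I ] π x∉) (leadsChain-∷-outside π I (N-tail y I x∉))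

  StableIn : ℕ → List (Fin n) → List (Fin n) → Set
  StableIn k U I = Unique U × length U ≡ k × Stable I × (∀ {v} → N[ I ] v ≡ true → v ∈ U)

  StableIn-∖ : ∀ {k U I x} → StableIn (suc k) U I → x ∈ U → N[ I ] x ≡ false → StableIn k (U ∖ x) I
  StableIn-∖ {x = x} (U-unique , len , stable , N⊆U) x∈ x∉ =
    ∖-unique x U-unique , ℕ.suc-injective (trans (length-∖ U-unique x∈) len) , stable ,
    λ v∈N → ∈-∖⁺ (N⊆U v∈N) (λ { refl → not-¬ v∈N x∉ })

  count-leadsChain : ∀ k {U I} → StableIn k U I → count (λ π → leadsChain π I) (orderings k U) ℕ.* nbhdProduct U I ≡ k !

  count-leadsChain-∖ : ∀ k {U I x} → StableIn (suc k) U I → x ∈ U → N[ I ] x ≡ false →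
    count (λ π → leadsChain π I) (orderings k (U ∖ x)) ℕ.* nbhdProduct U I ≡ k !
  count-leadsChain-∖ k {U} {I} {x} inside x∈ x∉ =
    trans (cong (count (λ π → leadsChain π I) (orderings k (U ∖ x)) ℕ.*_) (sym (nbhdProduct-∖ U I x∉)))
          (count-leadsChain k (StableIn-∖ inside x∈ x∉))

  count-leadsChain-head∉N : ∀ k {U} I → StableIn (suc k) U I →
    sumℕ U (λ x → if N[ I ] x then 0 else count (λ π → leadsChain (x ∷ π) I) (orderings k (U ∖ x)) ℕ.* nbhdProduct U I)
      ≡ count (λ x → not (N[ I ] x)) U ℕ.* k !
  count-leadsChain-head∉N k {U} I inside = trans (sumℕ-cong U term) (sumℕ-if (λ x → not (N[ I ] x)) (k !) U)
    where
    term : ∀ x → x ∈ U →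
      (if N[ I ] x then 0 else count (λ π → leadsChain (x ∷ π) I) (orderings k (U ∖ x)) ℕ.* nbhdProduct U I)
        ≡ (if not (N[ I ] x) then k ! else 0)
    term x x∈ with N[ I ] x in x∉
    ... | true  = refl
    ... | false = trans (cong (ℕ._* nbhdProduct U I)
                          (count-cong (orderings k (U ∖ x)) (λ π _ → leadsChain-∷-outside π I x∉)))
                        (count-leadsChain-∖ k inside x∈ x∉)

  count-leadsChain-head∈N : ∀ k {U} I → StableIn (suc k) U I →
    sumℕ U (λ x → if N[ I ] x then count (λ π → leadsChain (x ∷ π) I) (orderings k (U ∖ x)) ℕ.* nbhdProduct U I else 0)
      ≡ count N[ I ] U ℕ.* k !
  count-leadsChain-head∈N k {U} []      _ =
    trans (sumℕ-0 U (λ _ _ → refl)) (cong (ℕ._* k !) (sym (count-none _ U (λ _ _ → refl))))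
  count-leadsChain-head∈N k {U} (v ∷ J) (U-unique , len , (v∉ , J-stable) , N⊆U) =
    trans (sumℕ-single U-unique v∈ others) (begin
      (if N[ v ∷ J ] v then c v ℕ.* (cN ℕ.* nbhdProduct U J) else 0)
        ≡⟨ cong (λ b → if b then c v ℕ.* (cN ℕ.* nbhdProduct U J) else 0) (N-self v J) ⟩
      c v ℕ.* (cN ℕ.* nbhdProduct U J)
        ≡⟨ cong (ℕ._* (cN ℕ.* nbhdProduct U J)) (count-cong (orderings k (U ∖ v)) (λ π _ →
             cong₂ _∧_ (leads-∷-self N[ v ∷ J ] π (N-self v J)) (leadsChain-∷-outside π J v∉))) ⟩
      count (λ π → leadsChain π J) (orderings k (U ∖ v)) ℕ.* (cN ℕ.* nbhdProduct U J)
        ≡⟨ ℕ-*.x∙yz≈y∙xz (count (λ π → leadsChain π J) (orderings k (U ∖ v))) cN (nbhdProduct U J) ⟩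
      cN ℕ.* (count (λ π → leadsChain π J) (orderings k (U ∖ v)) ℕ.* nbhdProduct U J)
        ≡⟨ cong (cN ℕ.*_) (count-leadsChain-∖ k (U-unique , len , J-stable , N⊆U ∘ N-there v J) v∈ v∉) ⟩
      cN ℕ.* k ! ∎)
    where
    open ≡-Reasoning
    cN = count N[ v ∷ J ] U
    v∈ = N⊆U (N-self v J)
    c : Fin n → ℕ
    c x = count (λ π → leadsChain (x ∷ π) (v ∷ J)) (orderings k (U ∖ x))
    others : ∀ x → x ≢ v → (if N[ v ∷ J ] x then c x ℕ.* (cN ℕ.* nbhdProduct U J) else 0) ≡ 0
    others x x≢v with N[ v ∷ J ] x
    ... | false = refl
    ... | true  = cong (ℕ._* (cN ℕ.* nbhdProduct U J)) (count-none _ (orderings k (U ∖ x)) (λ π _ →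
                    cong (_∧ leadsChain (x ∷ π) J) (≢⇒==-false x≢v)))

  count-leadsChain zero    {[]} {[]}    _                    = refl
  count-leadsChain zero    {[]} {x ∷ I} (_ , _ , _ , N⊆U) with N⊆U (N-self x I)
  ... | ()
  count-leadsChain (suc k) {U}  {I}     inside@(_ , len , _) = begin
    count (λ π → leadsChain π I) (orderings (suc k) U) ℕ.* D
      ≡⟨ trans (cong (ℕ._* D) (count-orderings (λ π → leadsChain π I) k U)) (sumℕ-*ʳ U c D) ⟩
    sumℕ U (λ x → c x ℕ.* D)
      ≡⟨ sumℕ-split N[ I ] U (λ x → c x ℕ.* D) ⟩
    sumℕ U (λ x → if N[ I ] x then 0 else c x ℕ.* D) ℕ.+ sumℕ U (λ x → if N[ I ] x then c x ℕ.* D else 0)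
      ≡⟨ cong₂ ℕ._+_ (count-leadsChain-head∉N k I inside) (count-leadsChain-head∈N k I inside) ⟩
    count (λ x → not (N[ I ] x)) U ℕ.* k ! ℕ.+ count N[ I ] U ℕ.* k !
      ≡⟨ sym (ℕ.*-distribʳ-+ (k !) (count (λ x → not (N[ I ] x)) U) _) ⟩
    (count (λ x → not (N[ I ] x)) U ℕ.+ count N[ I ] U) ℕ.* k !
      ≡⟨ cong (ℕ._* k !) (trans (count-not+count N[ I ] U) len) ⟩
    suc k ! ∎
    where
    open ≡-Reasoning
    D = nbhdProduct U I
    c : Fin n → ℕ
    c x = count (λ π → leadsChain (x ∷ π) I) (orderings k (U ∖ x))

  count-leadsChain-headOutside : ∀ k {U I} → StableIn (suc k) U I →
    count (λ π → leadsChain π I ∧ headOutside π I) (orderings (suc k) U) ℕ.* nbhdProduct U I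
      ≡ count (λ x → not (N[ I ] x)) U ℕ.* k !
  count-leadsChain-headOutside k {U} {I} inside = begin
    count (λ π → leadsChain π I ∧ headOutside π I) (orderings (suc k) U) ℕ.* D
      ≡⟨ trans (cong (ℕ._* D) (count-orderings (λ π → leadsChain π I ∧ headOutside π I) k U)) (sumℕ-*ʳ U c D) ⟩
    sumℕ U (λ x → c x ℕ.* D)
      ≡⟨ sumℕ-cong U term ⟩
    sumℕ U (λ x → if N[ I ] x then 0 else count (λ π → leadsChain (x ∷ π) I) (orderings k (U ∖ x)) ℕ.* D)
      ≡⟨ count-leadsChain-head∉N k I inside ⟩
    count (λ x → not (N[ I ] x)) U ℕ.* k ! ∎
    where
    open ≡-Reasoning
    D = nbhdProduct U I
    c : Fin n → ℕ
    c x = count (λ π → leadsChain (x ∷ π) I ∧ not (N[ I ] x)) (orderings k (U ∖ x))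
    term : ∀ x → x ∈ U →
      c x ℕ.* D ≡ (if N[ I ] x then 0 else count (λ π → leadsChain (x ∷ π) I) (orderings k (U ∖ x)) ℕ.* D)
    term x _ with N[ I ] x
    ... | true  = cong (ℕ._* D) (count-none _ (orderings k (U ∖ x)) (λ π _ → ∧-zeroʳ _))
    ... | false = cong (ℕ._* D) (count-cong (orderings k (U ∖ x)) (λ π _ → ∧-identityʳ _))

  nonNeighbours≡count : ∀ I → nonNeighbours G I ≡ count (λ v → not (N[ I ] v)) (allFin n)
  nonNeighbours≡count I = trans (length-filter-T? _ (allFin n)) (count-cong (allFin n) (λ v _ → outside⇔ I v))
    where
    outside⇔ : ∀ I v → (not (any (λ u → ⌊ u Fin.≟ v ⌋) I) ∧ all (λ u → not (adj G u v)) I) ≡ not (N[ I ] v)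
    outside⇔ []      v = refl
    outside⇔ (u ∷ I) v with u Fin.≟ v | adj G u v
    ... | yes _ | _     = refl
    ... | no _  | true  = ∧-zeroʳ _
    ... | no _  | false = outside⇔ I v

  N-∈ : ∀ {I u v} → u ∈ I → u ≡ v ⊎ adj G u v ≡ true → N[ I ] v ≡ true
  N-∈ {u ∷ I} (here refl) (inj₁ refl) = N-self u I
  N-∈ {u ∷ I} (here refl) (inj₂ u~v)  = N-adj u I u~v
  N-∈ {w ∷ I} (there u∈)  u≈v         = N-there w I (N-∈ u∈ u≈v)

  Stable⇒Independent : ∀ {I} → Stable I → Independent G I
  Stable⇒Independent {[]}    _              = [] , []
  Stable⇒Independent {x ∷ I} (x∉ , stable) with Stable⇒Independent stable
  ... | I-unique , I-nonadjacent =
    All.tabulate (λ u∈ x≡u → not-¬ (N-∈ u∈ (inj₁ (sym x≡u))) x∉) ∷ I-unique ,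
    All.tabulate nonadjacent ∷ I-nonadjacent
    where
    nonadjacent : ∀ {u} → u ∈ I → adj G x u ≡ false
    nonadjacent {u} u∈ with adj G x u in x~u
    ... | false = refl
    ... | true  = ⊥-elim (not-¬ (N-∈ u∈ (inj₂ (trans (Graph.sym G u x) x~u))) x∉)

  Independent⇒Stable : ∀ {I} → Independent G I → Stable I
  Independent⇒Stable {[]}    _                                = tt
  Independent⇒Stable {x ∷ I} (x∉ ∷ I-unique , x≁ ∷ I-nonadj) =
    outside I x∉ x≁ , Independent⇒Stable (I-unique , I-nonadj)
    where
    outside : ∀ J → All (x ≢_) J → All (λ u → adj G x u ≡ false) J → N[ J ] x ≡ false
    outside []      _          _          = refl
    outside (u ∷ J) (x≢u ∷ ≢s) (x≁u ∷ ≁s) =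
      N-∷-false {u} {J} (x≢u ∘ sym) (trans (Graph.sym G u x) x≁u) (outside J ≢s ≁s)

  a₀≡n : ∀ α a → FullyRegular G α a → a 0 ≡ n
  a₀≡n α a regular = trans (sym (proj₂ regular [] ([] , [])))
    (trans (nonNeighbours≡count []) (trans (count-true (allFin n)) length-allFin))

module Regular {k : ℕ} (G : Graph (suc k)) {α : ℕ} {a : ℕ → ℕ} (regular : FullyRegular G α a) where

  open GraphProperties G
  open Orderings (Fin._≟_ {suc k})

  private
    V = allFin (suc k)
    V-unique = Unique.allFin⁺ (suc k)
    aℚ : ℕ → ℚ
    aℚ j = ℕtoℚ (a j)

  nonNeighbours-stable : ∀ {I} → Stable I → count (λ v → not (N[ I ] v)) V ≡ a (length I)
  nonNeighbours-stable {I} stable = trans (sym (nonNeighbours≡count I)) (proj₂ regular I (Stable⇒Independent stable))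

  stable-bound : ∀ J → Stable J → length J ≤ α
  stable-bound J stable = proj₂ (proj₁ regular) J (Stable⇒Independent stable)

  ℕtoℚ-count-N : ∀ {x J} → Stable (x ∷ J) → ℕtoℚ (count N[ x ∷ J ] V) ≡ aℚ 0 ℚ.- aℚ (suc (length J))
  ℕtoℚ-count-N {x} {J} stable = begin
    ℕtoℚ c                                ≡⟨ lemma (ℕtoℚ c) (aℚ (suc (length J))) ⟩
    (ℕtoℚ c ℚ.+ aℚ (suc (length J))) ℚ.- aℚ (suc (length J))
      ≡⟨ cong (ℚ._- aℚ (suc (length J))) (sym (ℕtoℚ-+ c _)) ⟩
    ℕtoℚ (c ℕ.+ a (suc (length J))) ℚ.- aℚ (suc (length J))
      ≡⟨ cong (λ m → ℕtoℚ m ℚ.- aℚ (suc (length J))) c+a≡a₀ ⟩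
    aℚ 0 ℚ.- aℚ (suc (length J))       ∎
    where
    open ≡-Reasoning
    open ℚSolver
    c = count N[ x ∷ J ] V
    lemma : ∀ p q → p ≡ (p ℚ.+ q) ℚ.- q
    lemma = solve 2 (λ p q → p := (p :+ q) :- q) refl
    c+a≡a₀ : c ℕ.+ a (suc (length J)) ≡ a 0
    c+a≡a₀ = begin
      c ℕ.+ a (suc (length J))                       ≡⟨ cong (c ℕ.+_) (sym (nonNeighbours-stable stable)) ⟩
      c ℕ.+ count (λ v → not (N[ x ∷ J ] v)) V       ≡⟨ ℕ.+-comm c _ ⟩
      count (λ v → not (N[ x ∷ J ] v)) V ℕ.+ c       ≡⟨ count-not+count N[ x ∷ J ] V ⟩
      length V                                       ≡⟨ List.length-tabulate (λ v → v) ⟩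
      suc k                                          ≡⟨ sym (a₀≡n α a regular) ⟩
      a 0                                            ∎

  nbhdProduct*gapInverses : ∀ I → Stable I → ℕtoℚ (nbhdProduct V I) ℚ.* gapInverses a (length I) ≡ 1ℚ
  nbhdProduct*gapInverses []      _                       = refl
  nbhdProduct*gapInverses (x ∷ J) stable@(_ , J-stable) = begin
    ℕtoℚ (c ℕ.* nbhdProduct V J) ℚ.* (gapInverses a (length J) ℚ.* inv)
      ≡⟨ cong (ℚ._* (gapInverses a (length J) ℚ.* inv)) (ℕtoℚ-* c (nbhdProduct V J)) ⟩
    ℕtoℚ c ℚ.* ℕtoℚ (nbhdProduct V J) ℚ.* (gapInverses a (length J) ℚ.* inv)
      ≡⟨ lemma (ℕtoℚ c) (ℕtoℚ (nbhdProduct V J)) (gapInverses a (length J)) inv ⟩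
    (ℕtoℚ c ℚ.* inv) ℚ.* (ℕtoℚ (nbhdProduct V J) ℚ.* gapInverses a (length J))
      ≡⟨ cong₂ ℚ._*_ c*inv≡1 (nbhdProduct*gapInverses J J-stable) ⟩
    1ℚ ∎
    where
    open ≡-Reasoning
    open ℚSolver
    c = count N[ x ∷ J ] V
    inv = 1ℚ ÷' (aℚ 0 ℚ.- aℚ (suc (length J)))
    lemma : ∀ c p r i → c ℚ.* p ℚ.* (r ℚ.* i) ≡ (c ℚ.* i) ℚ.* (p ℚ.* r)
    lemma = solve 4 (λ c p r i → c :* p :* (r :* i) := (c :* i) :* (p :* r)) refl
    c*inv≡1 : ℕtoℚ c ℚ.* inv ≡ 1ℚ
    c*inv≡1 = trans (cong (ℚ._* inv) (ℕtoℚ-count-N stable))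
      (*-1÷'-inverse (λ eq →
        ℕtoℚ-≢0 (count-≢0 N[ x ∷ J ] (∈.∈-allFin x) (N-self x J)) (trans (ℕtoℚ-count-N stable) eq)))

  κ : ℕ → ℚ
  κ i = aℚ i ℚ.* ℕtoℚ (k !) ℚ.* gapInverses a i

  ledCount≡κ : ∀ I → Stable I → ℕtoℚ (ledCount I) ≡ κ (length I)
  ledCount≡κ I stable = begin
    ℕtoℚ (ledCount I)
      ≡⟨ sym (trans (cong (ℕtoℚ (ledCount I) ℚ.*_) (nbhdProduct*gapInverses I stable))
                    (ℚ.*-identityʳ (ℕtoℚ (ledCount I)))) ⟩
    ℕtoℚ (ledCount I) ℚ.* (ℕtoℚ (nbhdProduct V I) ℚ.* gapInverses a (length I))
      ≡⟨ sym (trans (cong (ℚ._* gapInverses a (length I)) (ℕtoℚ-* (ledCount I) (nbhdProduct V I)))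
               (ℚ.*-assoc (ℕtoℚ (ledCount I)) (ℕtoℚ (nbhdProduct V I)) (gapInverses a (length I)))) ⟩
    ℕtoℚ (ledCount I ℕ.* nbhdProduct V I) ℚ.* gapInverses a (length I)
      ≡⟨ cong (λ m → ℕtoℚ m ℚ.* gapInverses a (length I))
           (count-leadsChain-headOutside k (V-unique , List.length-tabulate (λ v → v) , stable , λ {v} _ → ∈.∈-allFin v)) ⟩
    ℕtoℚ (count (λ x → not (N[ I ] x)) V ℕ.* k !) ℚ.* gapInverses a (length I)
      ≡⟨ cong (λ m → ℕtoℚ (m ℕ.* k !) ℚ.* gapInverses a (length I)) (nonNeighbours-stable stable) ⟩
    ℕtoℚ (a (length I) ℕ.* k !) ℚ.* gapInverses a (length I)
      ≡⟨ cong (ℚ._* gapInverses a (length I)) (ℕtoℚ-* (a (length I)) (k !)) ⟩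
    κ (length I) ∎
    where open ≡-Reasoning

  total≡horner : ∀ d I → Stable I → total d I ≡ horner κ aℚ d (length I)
  total≡horner zero    I stable = trans (total-zero I) (ledCount≡κ I stable)
  total≡horner (suc d) I stable = begin
    total (suc d) I
      ≡⟨ total-suc d I ⟩
    ℕtoℚ (ledCount I) ℚ.- sumℚ V (λ x → if not (N[ I ] x) then total d (x ∷ I) else 0ℚ)
      ≡⟨ cong₂ ℚ._-_ (ledCount≡κ I stable) (sumℚ-cong V (λ x _ → child x)) ⟩
    κ (length I) ℚ.- sumℚ V (λ x → if not (N[ I ] x) then horner κ aℚ d (suc (length I)) else 0ℚ)
      ≡⟨ cong (λ s → κ (length I) ℚ.- s) (sumℚ-if (λ x → not (N[ I ] x)) _ V) ⟩
    κ (length I) ℚ.- ℕtoℚ (count (λ x → not (N[ I ] x)) V) ℚ.* horner κ aℚ d (suc (length I))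
      ≡⟨ cong (λ m → κ (length I) ℚ.- ℕtoℚ m ℚ.* horner κ aℚ d (suc (length I))) (nonNeighbours-stable stable) ⟩
    horner κ aℚ (suc d) (length I) ∎
    where
    open ≡-Reasoning
    child : ∀ x → (if not (N[ I ] x) then total d (x ∷ I) else 0ℚ)
                ≡ (if not (N[ I ] x) then horner κ aℚ d (suc (length I)) else 0ℚ)
    child x with N[ I ] x in x∉
    ... | true  = refl
    ... | false = total≡horner d (x ∷ I) (x∉ , stable)

  ℕtoℚ-count-successiveᵇ : ℕtoℚ (count successiveᵇ allOrderings) ≡ ℕtoℚ (suc k !) ℚ.* sumTerm a α
  ℕtoℚ-count-successiveᵇ = begin
    ℕtoℚ (count successiveᵇ allOrderings)
      ≡⟨ sym (trans (sumℚ-if successiveᵇ 1ℚ allOrderings) (ℚ.*-identityʳ _)) ⟩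
    sumℚ allOrderings (λ π → 𝟙 (successiveᵇ π))
      ≡⟨ sumℚ-cong allOrderings (λ π _ → sym (chainSum≡𝟙successiveᵇ α stable-bound π)) ⟩
    total α []
      ≡⟨ total≡horner α [] tt ⟩
    horner κ aℚ α 0
      ≡⟨ horner-expansion κ aℚ α ⟩
    ∑≤ (λ m → ∏< (λ j → ℚ.- aℚ j) m ℚ.* κ m) α
      ≡⟨ ∑≤-cong α (weight*term≡prodTerm a (ℕtoℚ (k !))) ⟩
    ∑≤ (λ m → aℚ 0 ℚ.* ℕtoℚ (k !) ℚ.* prodTerm a m) α
      ≡⟨ ∑≤-*ˡ (aℚ 0 ℚ.* ℕtoℚ (k !)) (prodTerm a) α ⟩
    aℚ 0 ℚ.* ℕtoℚ (k !) ℚ.* ∑≤ (prodTerm a) α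
      ≡⟨ cong₂ ℚ._*_ a₀*k!≡n! (sym (sumTerm≡∑≤ a α)) ⟩
    ℕtoℚ (suc k !) ℚ.* sumTerm a α ∎
    where
    open ≡-Reasoning
    a₀*k!≡n! : aℚ 0 ℚ.* ℕtoℚ (k !) ≡ ℕtoℚ (suc k !)
    a₀*k!≡n! = trans (sym (ℕtoℚ-* (a 0) (k !))) (cong (λ m → ℕtoℚ (m ℕ.* k !)) (a₀≡n α a regular))

ℕtoℚ-count-successive : ∀ {n} (G : Graph n) α a → FullyRegular G α a → ∀ s → HasCount (SuccessiveOrdering G) s →
  ℕtoℚ s ≡ ℕtoℚ (n !) ℚ.* sumTerm a α
ℕtoℚ-count-successive {zero}  G α a regular s counted with proj₁ (proj₁ regular)
... | [] , _ , refl = trans (cong ℕtoℚ (GraphProperties.count-successive G s counted)) (sym (ℚ.*-identityʳ _))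
ℕtoℚ-count-successive {suc k} G α a regular s counted =
  trans (cong ℕtoℚ (GraphProperties.count-successive G s counted)) (Regular.ℕtoℚ-count-successiveᵇ G regular)

theorem2 : ∀ {n : ℕ} (G : Graph n) (α : ℕ) (a : ℕ → ℕ) → FullyRegular G α a →
    ∀ (s : ℕ) → HasCount (SuccessiveOrdering G) s →
      (ℕtoℚ s ÷' ℕtoℚ (n !) ≡ sumTerm a α)
      × (ℕtoℚ s ≡ ℕtoℚ (a 0 !) * sumTerm a α)
theorem2 {n} G α a regular s counted =
  trans (cong (_÷' ℕtoℚ (n !)) formula) (*-÷'-cancelˡ (sumTerm a α) (ℕtoℚ-≢0 (ℕ.≢-nonZero⁻¹ (n !) {{n !≢0}}))) ,
  trans formula (cong (λ m → ℕtoℚ (m !) * sumTerm a α) (sym (GraphProperties.a₀≡n G α a regular)))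
  where
  formula = ℕtoℚ-count-successive G α a regular s counted
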